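{- Let $q\ge2$ be a prime power and $n,d$ integers with $2\le d\le n$ and $d$ even, and let $b=-q$, $c=-1$. Let $Y$ be a $d$-code in $\mathrm{Her}_q(n)$ with \[ |Y|=(cb^n)^{n-d+1}\,\frac{(b^{n-d+2}-1)+b^n(b^{n-d+1}-1)}{b^{n-d+2}-b^{n-d+1}}. \] Then \[ \tfrac13 q^{n(n-d+2)-1}\le|Y|\le\tfrac12 q^{n(n-d+2)}. \]
   Context: $\mathrm{Her}_q(n)$ is the set of $n\times n$ Hermitian matrices over $\mathbb{F}_{q^2}$ ($A^*=A$, where $A^*$ is the transpose with $x\mapsto x^q$ applied entrywise); a $d$-code is a subset $Y$ with $\operatorname{rk}(x-y)\ge d$ for all distinct $x,y\in Y$. -}

module Defs where

open import Level using (0ℓ)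
open import Algebra.Bundles using (CommutativeRing)
open import Data.Nat using (ℕ; zero; suc)
open import Data.Fin using (Fin; zero; suc)
open import Data.Product using (Σ; _×_)
open import Relation.Nullary using (¬_)
open import Relation.Binary.PropositionalEquality using (_≡_; _≢_)

module _ (R : CommutativeRing 0ℓ 0ℓ) where
  open CommutativeRing R hiding (zero)

  IsField : Set
  IsField = (¬ (0# ≈ 1#)) × (∀ x → ¬ (x ≈ 0#) → Σ Carrier (λ y → (x * y) ≈ 1#))

  HasSize : ℕ → Set
  HasSize m = Σ (Fin m → Carrier) (λ e →
                 (∀ i j → e i ≈ e j → i ≡ j) × (∀ x → Σ (Fin m) (λ i → e i ≈ x)))

  pow : Carrier → ℕ → Carrier
  pow x zero    = 1#
  pow x (suc k) = x * pow x k

  sumF : (k : ℕ) → (Fin k → Carrier) → Carrier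
  sumF zero    f = 0#
  sumF (suc k) f = f zero + sumF k (λ i → f (suc i))

  Mat : ℕ → Set
  Mat n = Fin n → Fin n → Carrier

  _-M_ : ∀ {n} → Mat n → Mat n → Mat n
  (A -M B) i j = A i j + (- B i j)

  IsHermitian : (q : ℕ) → ∀ {n} → Mat n → Set
  IsHermitian q A = ∀ i j → A j i ≈ pow (A i j) q

  RankAtLeast : ∀ {n} → Mat n → ℕ → Set
  RankAtLeast {n} M d =
    Σ (Fin d → Fin n) (λ r →
      ∀ (c : Fin d → Carrier) →
        (∀ j → sumF d (λ k → c k * M (r k) j) ≈ 0#) → ∀ k → c k ≈ 0#)

  -- Y : Fin m → Her_q(n) is a d-code of size m: all members Hermitian,
  -- and rk(Y i - Y j) ≥ d for i ≠ j (which also forces distinctness since d ≥ 1)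
  IsHermDCode : (q n d m : ℕ) → (Fin m → Mat n) → Set
  IsHermDCode q n d m Y =
    (∀ i → IsHermitian q (Y i)) × (∀ i j → i ≢ j → RankAtLeast (Y i -M Y j) d)

-- Put b = -q and e = n - d + 1. As d is even, n and e have opposite parities, so every sign in the
-- size formula is fixed by the parity of e, and the formula becomes
--   (q + 1) q^e |Y| = q^(ne) (1 + q^(n+e) + (-1)^e (q^(e+1) - q^n)).
-- The main term q^(n(e+1)) / (q + 1) lies between q^(n(e+1)-1) / 3 and q^(n(e+1)) / 2 with
-- room to spare, and the correction term fits into that room because q^(e+1) ≤ q^n (as d ≥ 2) and,
-- when the correction is negative (e even), q^e ≥ q^2.
module Submission where

open import Defs
open import Level using (0ℓ)
open import Algebra.Bundles using (CommutativeRing)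
open import Data.Fin using (Fin)
open import Data.Integer as ℤ using (ℤ; +_; -1ℤ)
open import Data.List using ([]; _∷_)
import Data.Nat as ℕ
open import Data.Parity.Base as ℙ using (0ℙ; 1ℙ)
import Data.Parity.Properties as Parity
open import Data.Product using (Σ; _×_; _,_; map₂)
open import Data.Sum using (_⊎_; inj₁; inj₂; [_,_])
open import Relation.Binary.PropositionalEquality
  using (_≡_; refl; sym; trans; cong; cong₂; subst; module ≡-Reasoning)

module _ where
  open import Data.Integer using (-_; _+_; _*_; _-_; _^_; 1ℤ)
  open import Data.Integer.Properties
    using (pos-*; +-injective; ^-identityʳ; ^-distribˡ-+-*; -1*i≡-i; neg-involutive)
  open import Data.Integer.Tactic.RingSolver using (solve-∀)
  open ≡-Reasoning

  pos-^ : ∀ m k → (+ m) ^ k ≡ + (m ℕ.^ k)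
  pos-^ m ℕ.zero    = refl
  pos-^ m (ℕ.suc k) = trans (cong (+ m *_) (pos-^ m k)) (sym (pos-* m (m ℕ.^ k)))

  private
    neg-*-neg : ∀ i j → - i * (- i * j) ≡ i * (i * j)
    neg-*-neg = solve-∀

    *-*-neg : ∀ i j → i * (i * - j) ≡ - (i * (i * j))
    *-*-neg = solve-∀

  neg-^-even : ∀ i k → ℕ.parity k ≡ 0ℙ → (- i) ^ k ≡ i ^ k
  neg-^-even i 0                 _ = refl
  neg-^-even i (ℕ.suc (ℕ.suc k)) p = begin
    - i * (- i * (- i) ^ k) ≡⟨ cong (λ j → - i * (- i * j)) (neg-^-even i k p) ⟩
    - i * (- i * i ^ k)     ≡⟨ neg-*-neg i (i ^ k) ⟩
    i * (i * i ^ k)         ∎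

  neg-^-odd : ∀ i k → ℕ.parity k ≡ 1ℙ → (- i) ^ k ≡ - (i ^ k)
  neg-^-odd i 1                 _ = trans (^-identityʳ (- i)) (cong -_ (sym (^-identityʳ i)))
  neg-^-odd i (ℕ.suc (ℕ.suc k)) p = begin
    - i * (- i * (- i) ^ k) ≡⟨ cong (λ j → - i * (- i * j)) (neg-^-odd i k p) ⟩
    - i * (- i * - (i ^ k)) ≡⟨ neg-*-neg i (- (i ^ k)) ⟩
    i * (i * - (i ^ k))     ≡⟨ *-*-neg i (i ^ k) ⟩
    - (i * (i * i ^ k))     ∎

  -- The size formula with b ^ e, b ^ (e + 1), b ^ n and (c b ^ n) ^ e abstracted to β, β₁, γ and C.
  SizeEquation : (M β β₁ γ C : ℤ) → Set
  SizeEquation M β β₁ γ C = M * (β₁ - β) ≡ C * ((β₁ - 1ℤ) + γ * (β - 1ℤ))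

  SizeEquation-cong : ∀ {M β β′ β₁ β₁′ γ γ′ C C′} →
                      β ≡ β′ → β₁ ≡ β₁′ → γ ≡ γ′ → C ≡ C′ →
                      SizeEquation M β β₁ γ C → SizeEquation M β′ β₁′ γ′ C′
  SizeEquation-cong refl refl refl refl eq = eq

  size-equation-oddℤ : ∀ M Q W V Z → SizeEquation M (- W) (- W * - Q) V (- Z) →
                       M * ((1ℤ + Q) * W) + Z * (Q * W) ≡ Z * (1ℤ + V * W + V)
  size-equation-oddℤ M Q W V Z eq = begin
    M * ((1ℤ + Q) * W) + Z * (Q * W)                         ≡⟨ cong (_+ Z * (Q * W)) (lhs M Q W) ⟩
    M * (- W * - Q - - W) + Z * (Q * W)                      ≡⟨ cong (_+ Z * (Q * W)) eq ⟩
    - Z * ((- W * - Q - 1ℤ) + V * (- W - 1ℤ)) + Z * (Q * W) ≡⟨ rhs Q W V Z ⟩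
    Z * (1ℤ + V * W + V)                                     ∎
    where
    lhs : ∀ M Q W → M * ((1ℤ + Q) * W) ≡ M * (- W * - Q - - W)
    lhs = solve-∀
    rhs : ∀ Q W V Z → - Z * ((- W * - Q - 1ℤ) + V * (- W - 1ℤ)) + Z * (Q * W) ≡ Z * (1ℤ + V * W + V)
    rhs = solve-∀

  size-equation-evenℤ : ∀ M Q W V Z → SizeEquation M W (W * - Q) (- V) Z →
                        M * ((1ℤ + Q) * W) + Z * V ≡ Z * (1ℤ + V * W + Q * W)
  size-equation-evenℤ M Q W V Z eq = begin
    M * ((1ℤ + Q) * W) + Z * V                         ≡⟨ cong (_+ Z * V) (lhs M Q W) ⟩
    - (M * (W * - Q - W)) + Z * V                      ≡⟨ cong (λ x → - x + Z * V) eq ⟩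
    - (Z * ((W * - Q - 1ℤ) + - V * (W - 1ℤ))) + Z * V ≡⟨ rhs Q W V Z ⟩
    Z * (1ℤ + V * W + Q * W)                           ∎
    where
    lhs : ∀ M Q W → M * ((1ℤ + Q) * W) ≡ - (M * (W * - Q - W))
    lhs = solve-∀
    rhs : ∀ Q W V Z → - (Z * ((W * - Q - 1ℤ) + - V * (W - 1ℤ))) + Z * V ≡ Z * (1ℤ + V * W + Q * W)
    rhs = solve-∀

  private
    pos-*-* : ∀ a b c → + (a ℕ.* (b ℕ.* c)) ≡ + a * (+ b * + c)
    pos-*-* a b c = trans (pos-* a (b ℕ.* c)) (cong (+ a *_) (pos-* b c))

  size-equation-odd : ∀ {m q w v z} →
                      SizeEquation (+ m) (- + w) (- + w * - + q) (+ v) (- + z) →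
                      m ℕ.* ((1 ℕ.+ q) ℕ.* w) ℕ.+ z ℕ.* (q ℕ.* w) ≡ z ℕ.* (1 ℕ.+ v ℕ.* w ℕ.+ v)
  size-equation-odd {m} {q} {w} {v} {z} eq = +-injective (begin
    + (m ℕ.* ((1 ℕ.+ q) ℕ.* w) ℕ.+ z ℕ.* (q ℕ.* w)) ≡⟨ cong₂ _+_ (pos-*-* m (1 ℕ.+ q) w) (pos-*-* z q w) ⟩
    + m * ((1ℤ + + q) * + w) + + z * (+ q * + w)     ≡⟨ size-equation-oddℤ (+ m) (+ q) (+ w) (+ v) (+ z) eq ⟩
    + z * (1ℤ + + v * + w + + v)                    ≡⟨ cong (λ x → + z * (1ℤ + x + + v)) (pos-* v w) ⟨
    + z * + (1 ℕ.+ v ℕ.* w ℕ.+ v)                   ≡⟨ pos-* z _ ⟨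
    + (z ℕ.* (1 ℕ.+ v ℕ.* w ℕ.+ v))                 ∎)

  size-equation-even : ∀ {m q w v z} →
                       SizeEquation (+ m) (+ w) (+ w * - + q) (- + v) (+ z) →
                       m ℕ.* ((1 ℕ.+ q) ℕ.* w) ℕ.+ z ℕ.* v ≡ z ℕ.* (1 ℕ.+ v ℕ.* w ℕ.+ q ℕ.* w)
  size-equation-even {m} {q} {w} {v} {z} eq = +-injective (begin
    + (m ℕ.* ((1 ℕ.+ q) ℕ.* w) ℕ.+ z ℕ.* v)  ≡⟨ cong₂ _+_ (pos-*-* m (1 ℕ.+ q) w) (pos-* z v) ⟩
    + m * ((1ℤ + + q) * + w) + + z * + v     ≡⟨ size-equation-evenℤ (+ m) (+ q) (+ w) (+ v) (+ z) eq ⟩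
    + z * (1ℤ + + v * + w + + q * + w)       ≡⟨ cong₂ (λ x y → + z * (1ℤ + x + y)) (pos-* v w) (pos-* q w) ⟨
    + z * + (1 ℕ.+ v ℕ.* w ℕ.+ q ℕ.* w)      ≡⟨ pos-* z _ ⟨
    + (z ℕ.* (1 ℕ.+ v ℕ.* w ℕ.+ q ℕ.* w))    ∎)

  i^[k+1]≡i^k*i : ∀ i k → i ^ (k ℕ.+ 1) ≡ i ^ k * i
  i^[k+1]≡i^k*i i k = trans (^-distribˡ-+-* i k 1) (cong (i ^ k *_) (^-identityʳ i))

  odd-exponent-signs : ∀ M q n e → ℕ.parity e ≡ 1ℙ → ℕ.parity n ≡ 0ℙ →
                       SizeEquation M ((- + q) ^ e) ((- + q) ^ (e ℕ.+ 1)) ((- + q) ^ n) ((-1ℤ * (- + q) ^ n) ^ e) →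
                       SizeEquation M (- + (q ℕ.^ e)) (- + (q ℕ.^ e) * - + q) (+ (q ℕ.^ n)) (- + ((q ℕ.^ n) ℕ.^ e))
  odd-exponent-signs M q n e e-odd n-even =
    SizeEquation-cong {M = M} b^e≡-w (trans (i^[k+1]≡i^k*i (- + q) e) (cong (_* - + q) b^e≡-w)) b^n≡v (begin
      (-1ℤ * (- + q) ^ n) ^ e ≡⟨ cong (λ i → (-1ℤ * i) ^ e) b^n≡v ⟩
      (-1ℤ * + (q ℕ.^ n)) ^ e ≡⟨ cong (_^ e) (-1*i≡-i _) ⟩
      (- + (q ℕ.^ n)) ^ e     ≡⟨ neg-^-odd _ e e-odd ⟩
      - ((+ (q ℕ.^ n)) ^ e)   ≡⟨ cong -_ (pos-^ _ e) ⟩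
      - + ((q ℕ.^ n) ℕ.^ e)   ∎)
    where
    b^e≡-w : (- + q) ^ e ≡ - + (q ℕ.^ e)
    b^e≡-w = trans (neg-^-odd (+ q) e e-odd) (cong -_ (pos-^ q e))
    b^n≡v : (- + q) ^ n ≡ + (q ℕ.^ n)
    b^n≡v = trans (neg-^-even (+ q) n n-even) (pos-^ q n)

  even-exponent-signs : ∀ M q n e → ℕ.parity e ≡ 0ℙ → ℕ.parity n ≡ 1ℙ →
                        SizeEquation M ((- + q) ^ e) ((- + q) ^ (e ℕ.+ 1)) ((- + q) ^ n) ((-1ℤ * (- + q) ^ n) ^ e) →
                        SizeEquation M (+ (q ℕ.^ e)) (+ (q ℕ.^ e) * - + q) (- + (q ℕ.^ n)) (+ ((q ℕ.^ n) ℕ.^ e))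
  even-exponent-signs M q n e e-even n-odd =
    SizeEquation-cong {M = M} b^e≡w (trans (i^[k+1]≡i^k*i (- + q) e) (cong (_* - + q) b^e≡w)) b^n≡-v (begin
      (-1ℤ * (- + q) ^ n) ^ e     ≡⟨ cong (λ i → (-1ℤ * i) ^ e) b^n≡-v ⟩
      (-1ℤ * - + (q ℕ.^ n)) ^ e   ≡⟨ cong (_^ e) (trans (-1*i≡-i _) (neg-involutive _)) ⟩
      (+ (q ℕ.^ n)) ^ e           ≡⟨ pos-^ _ e ⟩
      + ((q ℕ.^ n) ℕ.^ e)         ∎)
    where
    b^e≡w : (- + q) ^ e ≡ + (q ℕ.^ e)
    b^e≡w = trans (neg-^-even (+ q) e e-even) (pos-^ q e)
    b^n≡-v : (- + q) ^ n ≡ - + (q ℕ.^ n)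
    b^n≡-v = trans (neg-^-odd (+ q) n n-odd) (cong -_ (pos-^ q n))

open import Data.Nat
  using (ℕ; suc; _+_; _*_; _∸_; _^_; _≤_; _<_; s≤s; z≤n; NonZero; >-nonZero; parity; nonTrivial⇒n>1)
open import Data.Nat.Properties
open import Data.Nat.Tactic.RingSolver using (solve)
open import Data.Nat.Divisibility using (_∣_; divides)
open import Data.Nat.Primality using (Prime; prime⇒nonZero; prime⇒nonTrivial)

x*k+j*c≤j*D⇒x≤j*m : ∀ {m k c D x} j → 0 < k → m * k + c ≡ D → x * k + j * c ≤ j * D → x ≤ j * m
x*k+j*c≤j*D⇒x≤j*m {m} {k} {c} {D} {x} j 0<k eq le =
  *-cancelʳ-≤ x (j * m) k {{>-nonZero 0<k}} (+-cancelʳ-≤ (j * c) (x * k) (j * m * k) (begin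
    x * k + j * c   ≤⟨ le ⟩
    j * D           ≡⟨ cong (j *_) (sym eq) ⟩
    j * (m * k + c) ≡⟨ solve (j ∷ m ∷ k ∷ c ∷ []) ⟩
    j * m * k + j * c ∎))
  where open ≤-Reasoning

j*D≤y*k+j*c⇒j*m≤y : ∀ {m k c D y} j → 0 < k → m * k + c ≡ D → j * D ≤ y * k + j * c → j * m ≤ y
j*D≤y*k+j*c⇒j*m≤y {m} {k} {c} {D} {y} j 0<k eq le =
  *-cancelʳ-≤ (j * m) y k {{>-nonZero 0<k}} (+-cancelʳ-≤ (j * c) (j * m * k) (y * k) (begin
    j * m * k + j * c ≡⟨ solve (j ∷ m ∷ k ∷ c ∷ []) ⟩
    j * (m * k + c)   ≡⟨ cong (j *_) eq ⟩
    j * D             ≤⟨ le ⟩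
    y * k + j * c     ∎))
  where open ≤-Reasoning

1+n≤2*n : ∀ {n} → 1 ≤ n → 1 + n ≤ 2 * n
1+n≤2*n {n} 1≤n = begin
  1 + n ≤⟨ +-monoˡ-≤ n 1≤n ⟩
  n + n ≡⟨ solve (n ∷ []) ⟩
  2 * n ∎
  where open ≤-Reasoning

1≤m*n : ∀ {m n} → 1 ≤ m → 1 ≤ n → 1 ≤ m * n
1≤m*n {m} {n} = *-mono-≤ {1} {m} {1} {n}

-- w, v, z and x stand for q ^ e, q ^ n, q ^ (n e) and q ^ (n (e + 1) - 1).
module _ {q w v z x m : ℕ} (2≤q : 2 ≤ q) (qw≤v : q * w ≤ v) (qx≡zv : q * x ≡ z * v) where

  private
    1≤q : 1 ≤ q
    1≤q = ≤-trans (s≤s z≤n) 2≤q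

    x*[q*k]≡z*v*k : ∀ k → x * (q * k) ≡ z * v * k
    x*[q*k]≡z*v*k k = begin
      x * (q * k) ≡⟨ solve (x ∷ q ∷ k ∷ []) ⟩
      q * x * k   ≡⟨ cong (_* k) qx≡zv ⟩
      z * v * k   ∎
      where open ≡-Reasoning

    0<[1+q]w : 1 ≤ w → 0 < (1 + q) * w
    0<[1+q]w 1≤w = 1≤m*n {1 + q} {w} (s≤s z≤n) 1≤w

    0<q[1+q]w : 1 ≤ w → 0 < q * ((1 + q) * w)
    0<q[1+q]w 1≤w = 1≤m*n 1≤q (0<[1+q]w 1≤w)

    scaled : ∀ {k c D} → m * k + c ≡ D → m * (q * k) + q * c ≡ q * D
    scaled {k} {c} {D} eq = begin
      m * (q * k) + q * c ≡⟨ solve (q ∷ m ∷ k ∷ c ∷ []) ⟩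
      q * (m * k + c)   ≡⟨ cong (q *_) eq ⟩
      q * D             ∎
      where open ≡-Reasoning

  size-bounds-odd : q ≤ w → m * ((1 + q) * w) + z * (q * w) ≡ z * (1 + v * w + v) →
                    x ≤ 3 * m × 2 * m ≤ z * v
  size-bounds-odd q≤w eq = lower , upper
    where
    open ≤-Reasoning
    2≤w : 2 ≤ w
    2≤w = ≤-trans 2≤q q≤w
    1≤w : 1 ≤ w
    1≤w = ≤-trans (s≤s z≤n) 2≤w
    lower : x ≤ 3 * m
    lower = x*k+j*c≤j*D⇒x≤j*m {m} {q * ((1 + q) * w)} 3 (0<q[1+q]w 1≤w) (scaled eq) (begin
      x * (q * ((1 + q) * w)) + 3 * (q * (z * (q * w))) ≡⟨ cong (_+ 3 * (q * (z * (q * w)))) (x*[q*k]≡z*v*k _) ⟩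
      z * v * ((1 + q) * w) + 3 * (q * (z * (q * w)))  ≡⟨ solve (z ∷ v ∷ w ∷ q ∷ []) ⟩
      z * ((1 + q) * (v * w) + 3 * q * (q * w))        ≤⟨ *-monoʳ-≤ z (+-mono-≤
                                                            (*-monoˡ-≤ (v * w) (1+n≤2*n 1≤q))
                                                            (*-monoʳ-≤ (3 * q) qw≤v)) ⟩
      z * (2 * q * (v * w) + 3 * q * v)                ≤⟨ *-monoʳ-≤ z (m≤n+m _ (3 * q + q * (v * w))) ⟩
      z * ((3 * q + q * (v * w)) + (2 * q * (v * w) + 3 * q * v)) ≡⟨ solve (z ∷ v ∷ w ∷ q ∷ []) ⟩
      3 * (q * (z * (1 + v * w + v)))                  ∎)
    upper : 2 * m ≤ z * v
    upper = j*D≤y*k+j*c⇒j*m≤y {m} {(1 + q) * w} 2 (0<[1+q]w 1≤w) eq (begin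
      2 * (z * (1 + v * w + v))          ≡⟨ solve (z ∷ v ∷ w ∷ []) ⟩
      z * (2 + 2 * (v * w) + 2 * v)      ≤⟨ *-monoʳ-≤ z (+-mono-≤ (+-mono-≤
                                              (*-monoʳ-≤ 2 (1≤m*n 1≤q 1≤w))
                                              (*-monoˡ-≤ (v * w) 2≤q))
                                              (*-monoˡ-≤ v 2≤w)) ⟩
      z * (2 * (q * w) + q * (v * w) + w * v) ≡⟨ solve (z ∷ v ∷ w ∷ q ∷ []) ⟩
      z * v * ((1 + q) * w) + 2 * (z * (q * w)) ∎)

  size-bounds-even : q * q ≤ w → m * ((1 + q) * w) + z * v ≡ z * (1 + v * w + q * w) →
                     x ≤ 3 * m × 2 * m ≤ z * v
  size-bounds-even qq≤w eq = lower , upper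
    where
    open ≤-Reasoning
    3≤w : 3 ≤ w
    3≤w = ≤-trans (n≤1+n 3) (≤-trans (*-mono-≤ 2≤q 2≤q) qq≤w)
    2≤w : 2 ≤ w
    2≤w = ≤-trans (n≤1+n 2) 3≤w
    1≤w : 1 ≤ w
    1≤w = ≤-trans (n≤1+n 1) 2≤w
    1≤v : 1 ≤ v
    1≤v = ≤-trans (1≤m*n 1≤q 1≤w) qw≤v
    lower : x ≤ 3 * m
    lower = x*k+j*c≤j*D⇒x≤j*m {m} {q * ((1 + q) * w)} 3 (0<q[1+q]w 1≤w) (scaled eq) (begin
      x * (q * ((1 + q) * w)) + 3 * (q * (z * v)) ≡⟨ cong (_+ 3 * (q * (z * v))) (x*[q*k]≡z*v*k _) ⟩
      z * v * ((1 + q) * w) + 3 * (q * (z * v))   ≡⟨ solve (z ∷ v ∷ w ∷ q ∷ []) ⟩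
      z * ((1 + q) * (v * w) + q * (3 * v))       ≤⟨ *-monoʳ-≤ z (+-mono-≤
                                                      (*-monoˡ-≤ (v * w) (1+n≤2*n 1≤q))
                                                      (*-monoʳ-≤ q (*-monoˡ-≤ v 3≤w))) ⟩
      z * (2 * q * (v * w) + q * (w * v))         ≡⟨ solve (z ∷ v ∷ w ∷ q ∷ []) ⟩
      z * (3 * q * (v * w))                       ≤⟨ *-monoʳ-≤ z (m≤m+n _ (3 * q + 3 * q * (q * w))) ⟩
      z * (3 * q * (v * w) + (3 * q + 3 * q * (q * w))) ≡⟨ solve (z ∷ v ∷ w ∷ q ∷ []) ⟩
      3 * (q * (z * (1 + v * w + q * w)))         ∎)
    upper : 2 * m ≤ z * v
    upper = j*D≤y*k+j*c⇒j*m≤y {m} {(1 + q) * w} 2 (0<[1+q]w 1≤w) eq (begin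
      2 * (z * (1 + v * w + q * w))              ≡⟨ solve (z ∷ v ∷ w ∷ q ∷ []) ⟩
      z * (2 + 2 * (v * w) + 2 * (q * w))        ≤⟨ *-monoʳ-≤ z (+-mono-≤ (+-mono-≤
                                                 (*-mono-≤ {2} {w} {1} {v} 2≤w 1≤v)
                                                 (*-monoˡ-≤ (v * w) 2≤q))
                                                 (*-monoʳ-≤ 2 qw≤v)) ⟩
      z * (w * v + q * (v * w) + 2 * v)          ≡⟨ solve (z ∷ v ∷ w ∷ q ∷ []) ⟩
      z * v * ((1 + q) * w) + 2 * (z * v)        ∎)

n≤n^k : ∀ n k .{{_ : NonZero n}} → 1 ≤ k → n ≤ n ^ k
n≤n^k n (suc k) _ = m≤m*n n (n ^ k) {{m^n≢0 n k}}

n*n≤n^k : ∀ n k .{{_ : NonZero n}} → 2 ≤ k → n * n ≤ n ^ k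
n*n≤n^k n (suc k) (s≤s 1≤k) = *-monoʳ-≤ n (n≤n^k n k 1≤k)

n*n^[k∸1]≡n^k : ∀ n k → 1 ≤ k → n * n ^ (k ∸ 1) ≡ n ^ k
n*n^[k∸1]≡n^k n (suc k) _ = refl

2≤p^k : ∀ {p k} → Prime p → 1 ≤ k → 2 ≤ p ^ k
2≤p^k {p} {k} p-prime 1≤k =
  ≤-trans (nonTrivial⇒n>1 p {{prime⇒nonTrivial p-prime}}) (n≤n^k p k {{prime⇒nonZero p-prime}} 1≤k)

1≤k∧even⇒2≤k : ∀ {k} → 1 ≤ k → parity k ≡ 0ℙ → 2 ≤ k
1≤k∧even⇒2≤k {1}             _ ()
1≤k∧even⇒2≤k {suc (suc k)} _ _ = s≤s (s≤s z≤n)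

parity[d+r]≡parity[r] : ∀ {d} r → 2 ∣ d → parity (d + r) ≡ parity r
parity[d+r]≡parity[r] {d} r (divides t d≡t*2) = begin
  parity (d + r)                ≡⟨ Parity.+-homo-+ d r ⟩
  parity d ℙ.+ parity r         ≡⟨ cong (ℙ._+ parity r) (cong parity d≡t*2) ⟩
  parity (t * 2) ℙ.+ parity r   ≡⟨ cong (ℙ._+ parity r) (Parity.*-homo-* t 2) ⟩
  parity t ℙ.* 0ℙ ℙ.+ parity r  ≡⟨ cong (ℙ._+ parity r) (Parity.*-zeroʳ (parity t)) ⟩
  parity r                      ∎
  where open ≡-Reasoning

exponent-parities : ∀ {n d} → d ≤ n → 2 ∣ d →
                    (parity (n ∸ d + 1) ≡ 1ℙ × parity n ≡ 0ℙ) ⊎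
                    (parity (n ∸ d + 1) ≡ 0ℙ × parity n ≡ 1ℙ)
exponent-parities {n} {d} d≤n 2∣d = by-parity (parity (n ∸ d)) refl
  where
  r : ℕ
  r = n ∸ d
  parity-n : parity n ≡ parity r
  parity-n = trans (cong parity (sym (m+[n∸m]≡n d≤n))) (parity[d+r]≡parity[r] r 2∣d)
  by-parity : ∀ p → parity r ≡ p →
              (parity (r + 1) ≡ 1ℙ × parity n ≡ 0ℙ) ⊎ (parity (r + 1) ≡ 0ℙ × parity n ≡ 1ℙ)
  by-parity 0ℙ pr = inj₁ (trans (Parity.+-homo-+ r 1) (cong (ℙ._+ 1ℙ) pr) , trans parity-n pr)
  by-parity 1ℙ pr = inj₂ (trans (Parity.+-homo-+ r 1) (cong (ℙ._+ 1ℙ) pr) , trans parity-n pr)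

size-bounds : ∀ {q n d m} → 2 ≤ q → 2 ≤ d → d ≤ n → 2 ∣ d →
              let b = ℤ.- (+ q)
                  e = n ∸ d + 1
              in SizeEquation (+ m) (b ℤ.^ e) (b ℤ.^ (e + 1)) (b ℤ.^ n) ((-1ℤ ℤ.* b ℤ.^ n) ℤ.^ e) →
              q ^ (n * (n ∸ d + 2) ∸ 1) ≤ 3 * m × 2 * m ≤ q ^ (n * (n ∸ d + 2))
size-bounds {q} {n} {d} {m} 2≤q 2≤d d≤n 2∣d eq =
  [ odd-exponent , even-exponent ] (exponent-parities d≤n 2∣d)
  where
  instance
    q≢0 : NonZero q
    q≢0 = >-nonZero (≤-trans (s≤s z≤n) 2≤q)

  r e N w v z : ℕ
  r = n ∸ d
  e = r + 1
  N = n * (r + 2)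
  w = q ^ e
  v = q ^ n
  z = v ^ e

  qw≤v : q * w ≤ v
  qw≤v = ^-monoʳ-≤ q (begin
    suc (r + 1) ≡⟨ +-suc r 1 ⟨
    r + 2       ≤⟨ +-monoʳ-≤ r 2≤d ⟩
    r + d       ≡⟨ +-comm r d ⟩
    d + r       ≡⟨ m+[n∸m]≡n d≤n ⟩
    n           ∎)
    where open ≤-Reasoning

  q^N≡zv : q ^ N ≡ z * v
  q^N≡zv = begin
    q ^ (n * (r + 2))    ≡⟨ cong (λ k → q ^ (n * k)) (+-suc r 1) ⟩
    q ^ (n * suc e)      ≡⟨ cong (q ^_) (*-suc n e) ⟩
    q ^ (n + n * e)      ≡⟨ ^-distribˡ-+-* q n (n * e) ⟩
    v * q ^ (n * e)      ≡⟨ cong (v *_) (^-*-assoc q n e) ⟨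
    v * z                ≡⟨ *-comm v z ⟩
    z * v                ∎
    where open ≡-Reasoning

  qx≡zv : q * q ^ (N ∸ 1) ≡ z * v
  qx≡zv = trans (n*n^[k∸1]≡n^k q N 1≤N) q^N≡zv
    where
    1≤N : 1 ≤ N
    1≤N = 1≤m*n (≤-trans (s≤s z≤n) (≤-trans 2≤d d≤n)) (≤-trans (n≤1+n 1) (m≤n+m 2 r))

  with-q^N : q ^ (N ∸ 1) ≤ 3 * m × 2 * m ≤ z * v → q ^ (N ∸ 1) ≤ 3 * m × 2 * m ≤ q ^ N
  with-q^N = map₂ (subst (2 * m ≤_) (sym q^N≡zv))

  odd-exponent : parity e ≡ 1ℙ × parity n ≡ 0ℙ → q ^ (N ∸ 1) ≤ 3 * m × 2 * m ≤ q ^ N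
  odd-exponent (e-odd , n-even) = with-q^N (size-bounds-odd {q} {w} {v} {z} {q ^ (N ∸ 1)} {m}
    2≤q qw≤v qx≡zv (n≤n^k q e (m≤n+m 1 r))
    (size-equation-odd {m} {q} {w} {v} {z} (odd-exponent-signs (+ m) q n e e-odd n-even eq)))

  even-exponent : parity e ≡ 0ℙ × parity n ≡ 1ℙ → q ^ (N ∸ 1) ≤ 3 * m × 2 * m ≤ q ^ N
  even-exponent (e-even , n-odd) = with-q^N (size-bounds-even {q} {w} {v} {z} {q ^ (N ∸ 1)} {m}
    2≤q qw≤v qx≡zv (n*n≤n^k q e (1≤k∧even⇒2≤k (m≤n+m 1 r) e-even))
    (size-equation-even {m} {q} {w} {v} {z} (even-exponent-signs (+ m) q n e e-even n-odd eq)))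

lemma8p14 : (q n d : ℕ) →
    Σ ℕ (λ p → Σ ℕ (λ k → Prime p × 1 ≤ k × q ≡ p ^ k)) →
    2 ≤ d → d ≤ n → 2 ∣ d →
    (F : CommutativeRing 0ℓ 0ℓ) → IsField F → HasSize F (q * q) →
    (m : ℕ) → (Y : Fin m → Mat F n) → IsHermDCode F q n d m Y →
    let b = ℤ.- (+ q)
        c = ℤ.- (+ 1)
        e = n ∸ d + 1
    in ((+ m) ℤ.* ((b ℤ.^ (e + 1)) ℤ.- (b ℤ.^ e))
          ≡ ((c ℤ.* (b ℤ.^ n)) ℤ.^ e)
              ℤ.* (((b ℤ.^ (e + 1)) ℤ.- (+ 1)) ℤ.+ ((b ℤ.^ n) ℤ.* ((b ℤ.^ e) ℤ.- (+ 1))))) →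
    (q ^ (n * (n ∸ d + 2) ∸ 1) ≤ 3 * m) × (2 * m ≤ q ^ (n * (n ∸ d + 2)))
lemma8p14 q n d (p , k , p-prime , 1≤k , q≡p^k) 2≤d d≤n 2∣d _ _ _ m _ _ size =
  size-bounds {m = m} (subst (2 ≤_) (sym q≡p^k) (2≤p^k p-prime 1≤k)) 2≤d d≤n 2∣d size
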